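{- Let $\ell \geq 1$ and $n$ be integers with $n \ge \ell+1$. Then $\Delta_{\ell+1}^{\ell} \,|\, \Delta_n^{\ell}$ if and only if $n+1 \in \mathcal{D}(\ell+2,\ell+1) \setminus \mathcal{X}(\ell+2,\ell+1)$.
   Context: $\Delta_n$ denotes the $n$-dimensional simplex (whose 1-skeleton is $K_{n+1}$); its $j$-faces correspond to the $(j+1)$-element subsets of its $n+1$ vertices. For a polytope $A$, $A^k$ denotes its $k$-skeleton. For polytopal $\ell$-complexes $L,K$, $L\,|\,K$ means $K$ and $L$ both have dimension $\ell$ and $K$ is a union of subcomplexes $L_1,\dots,L_r$, each isomorphic to $L$, such that every $\ell$-face of $K$ lies in exactly one $L_i$. A $(v,k,t)$-configuration is a $v$-element set together with a family of $k$-element subsets (blocks) such that every $t$-element subset lies in exactly one block. For $1\le t < k$, the divisibility set is $\mathcal{D}(k,t) = \{ v \ge k : \binom{k-h}{t-h} \text{ divides } \binom{v-h}{t-h} \text{ for all } 0 \le h \le t-1\}$, and $\mathcal{X}(k,t)$ denotes the set of $v \in \mathcal{D}(k,t)$ for which no $(v,k,t)$-configuration exists; by Keevash's theorem on the existence of designs, $\mathcal{X}(k,t)$ is finite, and a $(v,k,t)$-configuration exists iff $v \in \mathcal{D}(k,t)\setminus\mathcal{X}(k,t)$. The theorem is stated assuming Keevash's result. -}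

module Defs where

open import Data.Nat using (ℕ; suc; _+_; _∸_; _≤_; _<_)
open import Data.Nat.Divisibility using (_∣_)
open import Data.Nat.Combinatorics using (_C_)
open import Data.Fin using (Fin)
open import Data.Fin.Subset using (Subset; _⊆_; ∣_∣)
open import Data.Bool using (Bool; T)
open import Data.Product using (Σ; _×_; ∃-syntax)
open import Relation.Binary.PropositionalEquality using (_≡_)
open import Relation.Nullary using (¬_)

record Configuration (v k t : ℕ) : Set where
  field
    b       : ℕ
    block   : Fin b → Subset v
    blockSz : ∀ i → ∣ block i ∣ ≡ k
    unique  : ∀ (S : Subset v) → ∣ S ∣ ≡ t →
              Σ (Fin b) λ i → (S ⊆ block i) × (∀ j → S ⊆ block j → j ≡ i)

InD : (k t v : ℕ) → Set
InD k t v = (k ≤ v) × (∀ h → h < t → ((k ∸ h) C (t ∸ h)) ∣ ((v ∸ h) C (t ∸ h)))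

InX : (k t v : ℕ) → Set
InX k t v = InD k t v × ¬ Configuration v k t

IsFace : (ℓ n : ℕ) → Subset (suc n) → Set
IsFace ℓ n S = (1 ≤ ∣ S ∣) × (∣ S ∣ ≤ suc ℓ)

IsTopFace : (ℓ n : ℕ) → Subset (suc n) → Set
IsTopFace ℓ n S = ∣ S ∣ ≡ suc ℓ

record Subcomplex (ℓ n : ℕ) (L : Subset (suc n) → Bool) : Set where
  field
    faces  : ∀ S → T (L S) → IsFace ℓ n S
    closed : ∀ S R → T (L S) → R ⊆ S → 1 ≤ ∣ R ∣ → T (L R)

record IsoToBoundarySimplex (ℓ n : ℕ) (L : Subset (suc n) → Bool) : Set where
  field
    to      : (S : Subset (suc (suc ℓ))) → IsFace ℓ (suc ℓ) S → Subset (suc n)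
    to-in   : ∀ S p → T (L (to S p))
    from    : (R : Subset (suc n)) → T (L R) → Subset (suc (suc ℓ))
    from-in : ∀ R q → IsFace ℓ (suc ℓ) (from R q)
    from-to : ∀ S p → from (to S p) (to-in S p) ≡ S
    to-from : ∀ R q → to (from R q) (from-in R q) ≡ R
    mono    : ∀ S p S′ p′ → S ⊆ S′ → to S p ⊆ to S′ p′
    reflect : ∀ S p S′ p′ → to S p ⊆ to S′ p′ → S ⊆ S′

-- Δ_{ℓ+1}^ℓ | Δ_n^ℓ : Δ_n^ℓ is a union of subcomplexes L_1..L_r, each
-- isomorphic to Δ_{ℓ+1}^ℓ, with every ℓ-face lying in exactly one L_i.
record Decomposition (ℓ n : ℕ) : Set where
  field
    r     : ℕ
    L     : Fin r → Subset (suc n) → Bool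
    sub   : ∀ i → Subcomplex ℓ n (L i)
    iso   : ∀ i → IsoToBoundarySimplex ℓ n (L i)
    cover : ∀ S → IsFace ℓ n S → ∃[ i ] T (L i S)
    exact : ∀ S → IsTopFace ℓ n S →
            Σ (Fin r) λ i → T (L i S) × (∀ j → T (L j S) → j ≡ i)

{-# OPTIONS --safe #-}
-- A copy of Δ_{ℓ+1}^ℓ inside Δ_n^ℓ is the ℓ-skeleton of the simplex on ℓ + 2 of the n + 1 vertices: the
-- isomorphism sends the minimal faces (singletons) of Δ_{ℓ+1}^ℓ to singletons, so the copy has ℓ + 2 vertices,
-- and its ℓ-faces are exactly the (ℓ+1)-subsets of them. Hence decompositions of Δ_n^ℓ correspond to
-- (n+1, ℓ+2, ℓ+1)-configurations, the blocks being the vertex sets of the copies. A configuration satisfies the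
-- divisibility conditions, by double counting the blocks through a fixed h-set; and since the existence of a
-- configuration is decidable, not being exceptional provides one.
module Submission where

open import Defs
open import Data.Bool using (Bool; true; false; T; if_then_else_)
import Data.Bool.Properties as Bool
open import Data.Empty using (⊥-elim)
open import Data.Fin using (Fin; zero; suc; splitAt; join; _↑ˡ_; _↑ʳ_)
open import Data.Fin.Properties using (any?; injective⇒≤; splitAt-↑ˡ; splitAt-↑ʳ; join-splitAt)
  renaming (suc-injective to fsuc-injective)
open import Data.Fin.Subset using (Subset; _⊆_; _∈_; ∣_∣; ⊤; ⊥; ⁅_⁆; inside; outside; Nonempty)
open import Data.Fin.Subset.Properties
open import Data.Nat using (ℕ; zero; suc; _+_; _*_; _∸_; _≤_; _<_; z≤n; s≤s)
open import Data.Nat.Combinatorics using (_C_; nCk+nC[k+1]≡[n+1]C[k+1])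
open import Data.Nat.Divisibility using (_∣_; divides)
open import Data.Nat.Properties
open import Data.Product using (Σ; _×_; _,_; ∃; ∃!; ∃-syntax; proj₁; proj₂)
open import Data.Sum using (_⊎_; inj₁; inj₂; [_,_]′)
open import Data.Vec using ([]; _∷_; here; there; tabulate)
open import Data.Vec.Properties
  using (≡-dec; ∷-injectiveˡ; ∷-injectiveʳ; lookup∘tabulate; []=⇒lookup; lookup⇒[]=)
open import Function.Base using (_∘_; const)
open import Function.Bundles using (_⇔_; mk⇔; Equivalence)
open import Function.Definitions using (Injective)
open import Relation.Binary.PropositionalEquality
open import Relation.Nullary using (¬_; Dec; yes; no; does; isYes; contradiction)
open import Relation.Nullary.Decidable
  using ( T?; _×-dec_; _⊎-dec_; _→-dec_; ¬?; map′; dec-true; dec-false; does-⇔; decidable-stable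
        ; toWitness; fromWitness)
open import Relation.Unary using (Pred; Decidable)

open import Algebra.Properties.CommutativeSemigroup +-commutativeSemigroup
  using () renaming (interchange to +-interchange)
open import Algebra.Properties.CommutativeSemigroup *-commutativeSemigroup
  using () renaming (x∙yz≈y∙xz to *-left-comm)

-- Subsets of a finite set

in⊈out : ∀ {v} {p q : Subset v} → ¬ (inside ∷ p ⊆ outside ∷ q)
in⊈out p⊆q with p⊆q here
... | ()

1≤∣p∣⇒Nonempty : ∀ {v} (p : Subset v) → 1 ≤ ∣ p ∣ → Nonempty p
1≤∣p∣⇒Nonempty (inside ∷ p) _ = zero , here
1≤∣p∣⇒Nonempty (outside ∷ p) 1≤∣p∣ =
  let x , x∈p = 1≤∣p∣⇒Nonempty p 1≤∣p∣ in suc x , there x∈p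

x∈p⇒⁅x⁆⊆p : ∀ {v} {x : Fin v} {p : Subset v} → x ∈ p → ⁅ x ⁆ ⊆ p
x∈p⇒⁅x⁆⊆p {x = x} {p} x∈p y∈⁅x⁆ = subst (_∈ p) (sym (x∈⁅y⁆⇒x≡y x y∈⁅x⁆)) x∈p

x∈p⇒1≤∣p∣ : ∀ {v} {x : Fin v} {p : Subset v} → x ∈ p → 1 ≤ ∣ p ∣
x∈p⇒1≤∣p∣ {x = x} x∈p = subst (_≤ _) (∣⁅x⁆∣≡1 x) (p⊆q⇒∣p∣≤∣q∣ (x∈p⇒⁅x⁆⊆p x∈p))

⁅⁆-injective : ∀ {v} {x y : Fin v} → ⁅ x ⁆ ≡ ⁅ y ⁆ → x ≡ y
⁅⁆-injective {x = x} {y} ⁅x⁆≡⁅y⁆ = x∈⁅y⁆⇒x≡y y (subst (x ∈_) ⁅x⁆≡⁅y⁆ (x∈⁅x⁆ x))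

p⊆q∧∣q∣≤∣p∣⇒p≡q : ∀ {v} {p q : Subset v} → p ⊆ q → ∣ q ∣ ≤ ∣ p ∣ → p ≡ q
p⊆q∧∣q∣≤∣p∣⇒p≡q {p = []} {[]} _ _ = refl
p⊆q∧∣q∣≤∣p∣⇒p≡q {p = outside ∷ p} {outside ∷ q} p⊆q q≤p =
  cong (outside ∷_) (p⊆q∧∣q∣≤∣p∣⇒p≡q (drop-∷-⊆ p⊆q) q≤p)
p⊆q∧∣q∣≤∣p∣⇒p≡q {p = outside ∷ p} {inside ∷ q} p⊆q q<p =
  contradiction (p⊆q⇒∣p∣≤∣q∣ (drop-∷-⊆ p⊆q)) (<⇒≱ q<p)
p⊆q∧∣q∣≤∣p∣⇒p≡q {p = inside ∷ p} {outside ∷ q} p⊆q _ = ⊥-elim (in⊈out p⊆q)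
p⊆q∧∣q∣≤∣p∣⇒p≡q {p = inside ∷ p} {inside ∷ q} p⊆q (s≤s q≤p) =
  cong (inside ∷_) (p⊆q∧∣q∣≤∣p∣⇒p≡q (drop-∷-⊆ p⊆q) q≤p)

∃-superset-of-size : ∀ {v} (p : Subset v) {t} → ∣ p ∣ ≤ t → t ≤ v → ∃ λ q → p ⊆ q × ∣ q ∣ ≡ t
∃-superset-of-size [] {zero} _ _ = [] , (λ ()) , refl
∃-superset-of-size (inside ∷ p) {suc t} (s≤s p≤t) (s≤s t≤v) =
  let q , p⊆q , ∣q∣≡t = ∃-superset-of-size p p≤t t≤v in inside ∷ q , s⊆s p⊆q , cong suc ∣q∣≡t
∃-superset-of-size {suc v} (outside ∷ p) {t} p≤t t≤1+v with t ≤? v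
... | yes t≤v = let q , p⊆q , ∣q∣≡t = ∃-superset-of-size p p≤t t≤v in outside ∷ q , out⊆ p⊆q , ∣q∣≡t
... | no t≰v = let q , p⊆q , ∣q∣≡v = ∃-superset-of-size p (∣p∣≤n p) ≤-refl
               in inside ∷ q , out⊆ p⊆q , trans (cong suc ∣q∣≡v) (≤-antisym (≰⇒> t≰v) t≤1+v)

nth : ∀ {v} (p : Subset v) → Fin ∣ p ∣ → Fin v
nth (outside ∷ p) i = suc (nth p i)
nth (inside ∷ p) zero = zero
nth (inside ∷ p) (suc i) = suc (nth p i)

nth-∈ : ∀ {v} (p : Subset v) i → nth p i ∈ p
nth-∈ (outside ∷ p) i = there (nth-∈ p i)
nth-∈ (inside ∷ p) zero = here
nth-∈ (inside ∷ p) (suc i) = there (nth-∈ p i)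

nth-injective : ∀ {v} (p : Subset v) → Injective _≡_ _≡_ (nth p)
nth-injective (outside ∷ p) eq = nth-injective p (fsuc-injective eq)
nth-injective (inside ∷ p) {zero} {zero} _ = refl
nth-injective (inside ∷ p) {suc i} {suc j} eq = cong suc (nth-injective p (fsuc-injective eq))

index : ∀ {v} (p : Subset v) {x : Fin v} → x ∈ p → Fin ∣ p ∣
index (inside ∷ p) here = zero
index (outside ∷ p) (there x∈p) = index p x∈p
index (inside ∷ p) (there x∈p) = suc (index p x∈p)

nth-index : ∀ {v} (p : Subset v) {x : Fin v} (x∈p : x ∈ p) → nth p (index p x∈p) ≡ x
nth-index (inside ∷ p) here = refl
nth-index (outside ∷ p) (there x∈p) = cong suc (nth-index p x∈p)
nth-index (inside ∷ p) (there x∈p) = cong suc (nth-index p x∈p)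

injective-onto⇒∣p∣≡ : ∀ {m v} (p : Subset v) (φ : Fin m → Fin v) → Injective _≡_ _≡_ φ →
  (∀ j → φ j ∈ p) → (∀ {x} → x ∈ p → ∃ λ j → φ j ≡ x) → ∣ p ∣ ≡ m
injective-onto⇒∣p∣≡ {m} p φ φ-inj φ∈p onto = ≤-antisym (injective⇒≤ φ⁻¹∘nth-inj) (injective⇒≤ index∘φ-inj)
  where
  φ⁻¹∘nth : Fin ∣ p ∣ → Fin m
  φ⁻¹∘nth i = proj₁ (onto (nth-∈ p i))
  φ⁻¹∘nth-inj : Injective _≡_ _≡_ φ⁻¹∘nth
  φ⁻¹∘nth-inj {i} {j} eq = nth-injective p (begin
    nth p i             ≡⟨ proj₂ (onto (nth-∈ p i)) ⟨
    φ (φ⁻¹∘nth i)       ≡⟨ cong φ eq ⟩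
    φ (φ⁻¹∘nth j)       ≡⟨ proj₂ (onto (nth-∈ p j)) ⟩
    nth p j             ∎)
    where open ≡-Reasoning
  index∘φ-inj : Injective _≡_ _≡_ (λ j → index p (φ∈p j))
  index∘φ-inj {i} {j} eq = φ-inj (begin
    φ i                      ≡⟨ nth-index p (φ∈p i) ⟨
    nth p (index p (φ∈p i))  ≡⟨ cong (nth p) eq ⟩
    nth p (index p (φ∈p j))  ≡⟨ nth-index p (φ∈p j) ⟩
    φ j                      ∎)
    where open ≡-Reasoning

expand : ∀ {v m} (V : Subset v) → ∣ V ∣ ≡ m → Subset m → Subset v
expand [] refl [] = []
expand (outside ∷ V) e S = outside ∷ expand V e S
expand (inside ∷ V) e (x ∷ S) = x ∷ expand V (suc-injective e) S

compress : ∀ {v m} (V : Subset v) → ∣ V ∣ ≡ m → Subset v → Subset m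
compress [] refl [] = []
compress (outside ∷ V) e (_ ∷ R) = compress V e R
compress {m = zero} (inside ∷ V) () _
compress {m = suc m} (inside ∷ V) e (x ∷ R) = x ∷ compress V (suc-injective e) R

compress-expand : ∀ {v m} (V : Subset v) (e : ∣ V ∣ ≡ m) S → compress V e (expand V e S) ≡ S
compress-expand [] refl [] = refl
compress-expand (outside ∷ V) e S = compress-expand V e S
compress-expand {m = suc m} (inside ∷ V) e (x ∷ S) = cong (x ∷_) (compress-expand V _ S)

expand-compress : ∀ {v m} (V : Subset v) (e : ∣ V ∣ ≡ m) {R} → R ⊆ V → expand V e (compress V e R) ≡ R
expand-compress [] refl {[]} _ = refl
expand-compress (outside ∷ V) e {outside ∷ R} R⊆V = cong (outside ∷_) (expand-compress V e (drop-∷-⊆ R⊆V))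
expand-compress (outside ∷ V) e {inside ∷ R} R⊆V = ⊥-elim (in⊈out R⊆V)
expand-compress {m = zero} (inside ∷ V) () _
expand-compress {m = suc m} (inside ∷ V) e {x ∷ R} R⊆V = cong (x ∷_) (expand-compress V _ (drop-∷-⊆ R⊆V))

∣expand∣≡∣S∣ : ∀ {v m} (V : Subset v) (e : ∣ V ∣ ≡ m) S → ∣ expand V e S ∣ ≡ ∣ S ∣
∣expand∣≡∣S∣ [] refl [] = refl
∣expand∣≡∣S∣ (outside ∷ V) e S = ∣expand∣≡∣S∣ V e S
∣expand∣≡∣S∣ (inside ∷ V) e (outside ∷ S) = ∣expand∣≡∣S∣ V _ S
∣expand∣≡∣S∣ (inside ∷ V) e (inside ∷ S) = cong suc (∣expand∣≡∣S∣ V _ S)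

expand⊆V : ∀ {v m} (V : Subset v) (e : ∣ V ∣ ≡ m) S → expand V e S ⊆ V
expand⊆V (outside ∷ V) e S (there x∈) = there (expand⊆V V e S x∈)
expand⊆V (inside ∷ V) e (inside ∷ S) here = here
expand⊆V (inside ∷ V) e (_ ∷ S) (there x∈) = there (expand⊆V V _ S x∈)

expand-mono : ∀ {v m} (V : Subset v) (e : ∣ V ∣ ≡ m) {S S′} → S ⊆ S′ → expand V e S ⊆ expand V e S′
expand-mono (outside ∷ V) e S⊆S′ (there x∈) = there (expand-mono V e S⊆S′ x∈)
expand-mono (inside ∷ V) e {inside ∷ S} {_ ∷ S′} S⊆S′ here with S⊆S′ here
... | here = here
expand-mono (inside ∷ V) e {_ ∷ S} {_ ∷ S′} S⊆S′ (there x∈) = there (expand-mono V _ (drop-∷-⊆ S⊆S′) x∈)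

expand-reflect : ∀ {v m} (V : Subset v) (e : ∣ V ∣ ≡ m) {S S′} → expand V e S ⊆ expand V e S′ → S ⊆ S′
expand-reflect [] refl {[]} _ ()
expand-reflect (outside ∷ V) e E⊆E′ = expand-reflect V e (drop-∷-⊆ E⊆E′)
expand-reflect (inside ∷ V) e {inside ∷ S} {_ ∷ S′} E⊆E′ here with E⊆E′ here
... | here = here
expand-reflect (inside ∷ V) e {_ ∷ S} {_ ∷ S′} E⊆E′ (there j∈) =
  there (expand-reflect V _ (drop-∷-⊆ E⊆E′) j∈)

∣compress∣≡∣R∣ : ∀ {v m} (V : Subset v) (e : ∣ V ∣ ≡ m) {R} → R ⊆ V → ∣ compress V e R ∣ ≡ ∣ R ∣
∣compress∣≡∣R∣ [] refl {[]} _ = refl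
∣compress∣≡∣R∣ (outside ∷ V) e {outside ∷ R} R⊆V = ∣compress∣≡∣R∣ V e (drop-∷-⊆ R⊆V)
∣compress∣≡∣R∣ (outside ∷ V) e {inside ∷ R} R⊆V = ⊥-elim (in⊈out R⊆V)
∣compress∣≡∣R∣ {m = zero} (inside ∷ V) () _
∣compress∣≡∣R∣ {m = suc m} (inside ∷ V) e {outside ∷ R} R⊆V = ∣compress∣≡∣R∣ V _ (drop-∷-⊆ R⊆V)
∣compress∣≡∣R∣ {m = suc m} (inside ∷ V) e {inside ∷ R} R⊆V = cong suc (∣compress∣≡∣R∣ V _ (drop-∷-⊆ R⊆V))

-- Sums over all subsets of Fin v

𝟙[_] : ∀ {a} {A : Set a} → Dec A → ℕ
𝟙[ a? ] = if does a? then 1 else 0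

𝟙-yes : ∀ {a} {A : Set a} (a? : Dec A) → A → 𝟙[ a? ] ≡ 1
𝟙-yes a? a rewrite dec-true a? a = refl

𝟙-no : ∀ {a} {A : Set a} (a? : Dec A) → ¬ A → 𝟙[ a? ] ≡ 0
𝟙-no a? ¬a rewrite dec-false a? ¬a = refl

𝟙-× : ∀ {a b} {A : Set a} {B : Set b} (a? : Dec A) (b? : Dec B) → 𝟙[ a? ×-dec b? ] ≡ 𝟙[ a? ] * 𝟙[ b? ]
𝟙-× a? b? with does a? | does b?
... | true | true = refl
... | true | false = refl
... | false | _ = refl

𝟙-*-cong : ∀ {a} {A : Set a} (a? : Dec A) {x y} → (A → x ≡ y) → 𝟙[ a? ] * x ≡ 𝟙[ a? ] * y
𝟙-*-cong (yes a) x≡y = cong (_+ 0) (x≡y a)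
𝟙-*-cong (no _) _ = refl

∑ : ∀ {v} → (Subset v → ℕ) → ℕ
∑ {zero} f = f []
∑ {suc v} f = ∑ (f ∘ (outside ∷_)) + ∑ (f ∘ (inside ∷_))

∑-cong : ∀ {v} {f g : Subset v → ℕ} → f ≗ g → ∑ f ≡ ∑ g
∑-cong {zero} f≗g = f≗g []
∑-cong {suc v} f≗g = cong₂ _+_ (∑-cong (f≗g ∘ (outside ∷_))) (∑-cong (f≗g ∘ (inside ∷_)))

∑-zero : ∀ {v} {f : Subset v → ℕ} → (∀ S → f S ≡ 0) → ∑ f ≡ 0
∑-zero {zero} f≡0 = f≡0 []
∑-zero {suc v} f≡0 = cong₂ _+_ (∑-zero (f≡0 ∘ (outside ∷_))) (∑-zero (f≡0 ∘ (inside ∷_)))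

∑-+ : ∀ {v} (f g : Subset v → ℕ) → ∑ (λ S → f S + g S) ≡ ∑ f + ∑ g
∑-+ {zero} f g = refl
∑-+ {suc v} f g = trans (cong₂ _+_ (∑-+ f₀ g₀) (∑-+ f₁ g₁)) (+-interchange (∑ f₀) (∑ g₀) (∑ f₁) (∑ g₁))
  where
  f₀ f₁ g₀ g₁ : Subset v → ℕ
  f₀ = f ∘ (outside ∷_)
  f₁ = f ∘ (inside ∷_)
  g₀ = g ∘ (outside ∷_)
  g₁ = g ∘ (inside ∷_)

∑-*ˡ : ∀ {v} c (f : Subset v → ℕ) → ∑ (λ S → c * f S) ≡ c * ∑ f
∑-*ˡ {zero} c f = refl
∑-*ˡ {suc v} c f =
  trans (cong₂ _+_ (∑-*ˡ c (f ∘ (outside ∷_))) (∑-*ˡ c (f ∘ (inside ∷_)))) (sym (*-distribˡ-+ c _ _))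

∑-swap : ∀ {v w} (f : Subset v → Subset w → ℕ) → ∑ (λ S → ∑ (f S)) ≡ ∑ (λ R → ∑ (λ S → f S R))
∑-swap {zero} f = refl
∑-swap {suc v} f =
  trans (cong₂ _+_ (∑-swap (f ∘ (outside ∷_))) (∑-swap (f ∘ (inside ∷_))))
        (sym (∑-+ (λ R → ∑ (λ S → f (outside ∷ S) R)) (λ R → ∑ (λ S → f (inside ∷ S) R))))

∑-*ʳ : ∀ {v} c (f : Subset v → ℕ) → ∑ (λ S → f S * c) ≡ ∑ f * c
∑-*ʳ c f = trans (∑-cong λ S → *-comm (f S) c) (trans (∑-*ˡ c f) (*-comm c (∑ f)))

_≟ˢ_ : ∀ {v} (S R : Subset v) → Dec (S ≡ R)
_≟ˢ_ = ≡-dec Bool._≟_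

∑-𝟙-≡ : ∀ {v} (S₀ : Subset v) → ∑ (λ S → 𝟙[ S ≟ˢ S₀ ]) ≡ 1
∑-𝟙-≡ [] = refl
∑-𝟙-≡ {suc v} (outside ∷ S₀) = cong₂ _+_ (∑-𝟙-≡ S₀) (∑-zero {v} λ _ → refl)
∑-𝟙-≡ {suc v} (inside ∷ S₀) = cong₂ _+_ (∑-zero {v} λ _ → refl) (∑-𝟙-≡ S₀)

∑-𝟙-unique : ∀ {v p} {P : Pred (Subset v) p} (P? : Decidable P) {S₀} → P S₀ → (∀ {S} → P S → S ≡ S₀) →
  ∑ (λ S → 𝟙[ P? S ]) ≡ 1
∑-𝟙-unique {P = P} P? {S₀} PS₀ unique = trans (∑-cong 𝟙P≗𝟙≡) (∑-𝟙-≡ S₀)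
  where
  𝟙P≗𝟙≡ : ∀ S → 𝟙[ P? S ] ≡ 𝟙[ S ≟ˢ S₀ ]
  𝟙P≗𝟙≡ S = cong (if_then 1 else 0) (does-⇔ (mk⇔ unique λ { refl → PS₀ }) (P? S) (S ≟ˢ S₀))

between : ∀ {v} → Subset v → Subset v → ℕ → Subset v → ℕ
between H B t X = 𝟙[ ∣ X ∣ ≟ t ] * (𝟙[ H ⊆? X ] * 𝟙[ X ⊆? B ])

between≡0 : ∀ {v} (H B : Subset v) t X → (∣ X ∣ ≡ t → H ⊆ X → ¬ X ⊆ B) → between H B t X ≡ 0
between≡0 H B t X ¬between with H ⊆? X | X ⊆? B
... | yes H⊆X | yes X⊆B = cong (_* 1) (𝟙-no (∣ X ∣ ≟ t) λ ∣X∣≡t → ¬between ∣X∣≡t H⊆X X⊆B)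
... | no _    | _       = *-zeroʳ 𝟙[ ∣ X ∣ ≟ t ]
... | yes _   | no _    = *-zeroʳ 𝟙[ ∣ X ∣ ≟ t ]

∑-between-⊈ : ∀ {v} {H B : Subset v} t → ¬ H ⊆ B → ∑ (between H B t) ≡ 0
∑-between-⊈ {H = H} {B} t H⊈B = ∑-zero λ X → between≡0 H B t X λ _ H⊆X X⊆B → H⊈B (⊆-trans H⊆X X⊆B)

∑-between-< : ∀ {v} {H B : Subset v} {t} → t < ∣ H ∣ → ∑ (between H B t) ≡ 0
∑-between-< {H = H} {B} {t} t<∣H∣ = ∑-zero λ X → between≡0 H B t X λ ∣X∣≡t H⊆X _ →
  <⇒≱ t<∣H∣ (subst (∣ H ∣ ≤_) ∣X∣≡t (p⊆q⇒∣p∣≤∣q∣ H⊆X))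

C-pascal-∸ : ∀ {b h t} → h ≤ b → h ≤ t →
  (b ∸ h) C (suc t ∸ h) + (b ∸ h) C (t ∸ h) ≡ (suc b ∸ h) C (suc t ∸ h)
C-pascal-∸ {b} {h} {t} h≤b h≤t = begin
  m C (suc t ∸ h) + m C (t ∸ h)   ≡⟨ cong (λ k → m C k + m C (t ∸ h)) (+-∸-assoc 1 h≤t) ⟩
  m C suc (t ∸ h) + m C (t ∸ h)   ≡⟨ +-comm (m C suc (t ∸ h)) _ ⟩
  m C (t ∸ h) + m C suc (t ∸ h)   ≡⟨ nCk+nC[k+1]≡[n+1]C[k+1] m (t ∸ h) ⟩
  suc m C suc (t ∸ h)             ≡⟨ cong₂ _C_ (+-∸-assoc 1 h≤b) (+-∸-assoc 1 h≤t) ⟨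
  (suc b ∸ h) C (suc t ∸ h)       ∎
  where
  open ≡-Reasoning
  m : ℕ
  m = b ∸ h

C-∸-boundary : ∀ b {h t} → t ≤ h → (b ∸ h) C (t ∸ h) ≡ (suc b ∸ h) C (t ∸ h)
C-∸-boundary b {h} {t} t≤h rewrite m≤n⇒m∸n≡0 t≤h = refl

∑-between : ∀ {v} (H B : Subset v) t → H ⊆ B → ∣ H ∣ ≤ t →
  ∑ (between H B t) ≡ (∣ B ∣ ∸ ∣ H ∣) C (t ∸ ∣ H ∣)
∑-between [] [] zero _ _ = refl
∑-between [] [] (suc t) _ _ = refl
∑-between (outside ∷ H) (outside ∷ B) t H⊆B h≤t =
  trans (cong₂ _+_ (∑-between H B t (drop-∷-⊆ H⊆B) h≤t)
                   (∑-zero λ X → between≡0 (outside ∷ H) (outside ∷ B) t (inside ∷ X) λ _ _ → in⊈out))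
        (+-identityʳ _)
∑-between {suc v} (outside ∷ H) (inside ∷ B) zero H⊆B h≤0 =
  trans (cong₂ _+_ (∑-between H B 0 (drop-∷-⊆ H⊆B) h≤0) (∑-zero {v} λ _ → refl))
        (trans (+-identityʳ _) (C-∸-boundary ∣ B ∣ {∣ H ∣} z≤n))
∑-between (outside ∷ H) (inside ∷ B) (suc t) H⊆B h≤1+t with ∣ H ∣ ≤? t
... | yes h≤t =
  trans (cong₂ _+_ (∑-between H B (suc t) (drop-∷-⊆ H⊆B) h≤1+t) (∑-between H B t (drop-∷-⊆ H⊆B) h≤t))
        (C-pascal-∸ (p⊆q⇒∣p∣≤∣q∣ (drop-∷-⊆ H⊆B)) h≤t)
... | no h≰t =
  trans (cong₂ _+_ (∑-between H B (suc t) (drop-∷-⊆ H⊆B) h≤1+t) (∑-between-< {H = H} {B} (≰⇒> h≰t)))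
        (trans (+-identityʳ _) (C-∸-boundary ∣ B ∣ {∣ H ∣} (≰⇒> h≰t)))
∑-between (inside ∷ H) (outside ∷ B) _ H⊆B _ = ⊥-elim (in⊈out H⊆B)
∑-between (inside ∷ H) (inside ∷ B) (suc t) H⊆B (s≤s h≤t) =
  cong₂ _+_ (∑-zero λ X → between≡0 (inside ∷ H) (inside ∷ B) (suc t) (outside ∷ X) λ _ H⊆X _ → in⊈out H⊆X)
            (∑-between H B t (drop-∷-⊆ H⊆B) h≤t)

-- Designs

-- A configuration given by the characteristic function of its set of blocks. Unlike `Configuration`, these
-- range over a finite type, which makes their existence decidable.
record IsDesign (v k t : ℕ) (f : Subset v → Bool) : Set where
  constructor mkIsDesign
  field
    block-size   : ∀ B → T (f B) → ∣ B ∣ ≡ k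
    unique-block : ∀ S → ∣ S ∣ ≡ t → ∃! _≡_ λ B → T (f B) × S ⊆ B

module _ {v k t : ℕ} {f : Subset v → Bool} (design : IsDesign v k t f) where

  open IsDesign design

  𝟙-block : Subset v → ℕ
  𝟙-block B = 𝟙[ T? (f B) ]

  blocks-containing : Subset v → ℕ
  blocks-containing X = ∑ λ B → 𝟙-block B * 𝟙[ X ⊆? B ]

  blocks-containing-t-set : ∀ X → ∣ X ∣ ≡ t → blocks-containing X ≡ 1
  blocks-containing-t-set X ∣X∣≡t =
    let B , (fB , X⊆B) , unique = unique-block X ∣X∣≡t in
    trans (∑-cong λ B′ → sym (𝟙-× (T? (f B′)) (X ⊆? B′)))
          (∑-𝟙-unique (λ B′ → T? (f B′) ×-dec X ⊆? B′) (fB , X⊆B) (sym ∘ unique))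

  ∑-between-block : ∀ {H B} → ∣ H ∣ ≤ t → T (f B) →
    𝟙[ H ⊆? B ] * ((k ∸ ∣ H ∣) C (t ∸ ∣ H ∣)) ≡ ∑ (between H B t)
  ∑-between-block {H} {B} h≤t fB with H ⊆? B
  ... | no H⊈B = sym (∑-between-⊈ t H⊈B)
  ... | yes H⊆B = begin
    (k ∸ ∣ H ∣) C (t ∸ ∣ H ∣) + 0        ≡⟨ +-identityʳ _ ⟩
    (k ∸ ∣ H ∣) C (t ∸ ∣ H ∣)            ≡⟨ cong (λ n → (n ∸ ∣ H ∣) C (t ∸ ∣ H ∣)) (block-size B fB) ⟨
    (∣ B ∣ ∸ ∣ H ∣) C (t ∸ ∣ H ∣)        ≡⟨ ∑-between H B t H⊆B h≤t ⟨
    ∑ (between H B t)                    ∎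
    where open ≡-Reasoning

  ∑-blocks-between : ∀ H X → ∑ (λ B → 𝟙-block B * between H B t X) ≡ between H ⊤ t X
  ∑-blocks-between H X = begin
    ∑ (λ B → 𝟙-block B * (𝟙ₜ * (𝟙ₕ * 𝟙[ X ⊆? B ])))   ≡⟨ ∑-cong (λ B → rearrange (𝟙-block B) 𝟙[ X ⊆? B ]) ⟩
    ∑ (λ B → 𝟙ₜ * (𝟙ₕ * (𝟙-block B * 𝟙[ X ⊆? B ])))   ≡⟨ ∑-*ˡ 𝟙ₜ (λ B → 𝟙ₕ * (𝟙-block B * 𝟙[ X ⊆? B ])) ⟩
    𝟙ₜ * ∑ (λ B → 𝟙ₕ * (𝟙-block B * 𝟙[ X ⊆? B ]))
      ≡⟨ cong (𝟙ₜ *_) (∑-*ˡ 𝟙ₕ (λ B → 𝟙-block B * 𝟙[ X ⊆? B ])) ⟩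
    𝟙ₜ * (𝟙ₕ * blocks-containing X)
      ≡⟨ 𝟙-*-cong (∣ X ∣ ≟ t) (cong (𝟙ₕ *_) ∘ blocks-containing-t-set X) ⟩
    𝟙ₜ * (𝟙ₕ * 1)                                     ≡⟨ cong (λ n → 𝟙ₜ * (𝟙ₕ * n)) (𝟙-yes (X ⊆? ⊤) ⊆⊤) ⟨
    between H ⊤ t X                                   ∎
    where
    open ≡-Reasoning
    𝟙ₜ 𝟙ₕ : ℕ
    𝟙ₜ = 𝟙[ ∣ X ∣ ≟ t ]
    𝟙ₕ = 𝟙[ H ⊆? X ]
    rearrange : ∀ a b → a * (𝟙ₜ * (𝟙ₕ * b)) ≡ 𝟙ₜ * (𝟙ₕ * (a * b))
    rearrange a b = trans (*-left-comm a 𝟙ₜ _) (cong (𝟙ₜ *_) (*-left-comm a 𝟙ₕ b))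

  -- Double counting the pairs (B , X) of a block B and a t-set X with H ⊆ X ⊆ B.
  blocks-containing-×-C : ∀ H → ∣ H ∣ ≤ t →
    blocks-containing H * ((k ∸ ∣ H ∣) C (t ∸ ∣ H ∣)) ≡ (v ∸ ∣ H ∣) C (t ∸ ∣ H ∣)
  blocks-containing-×-C H h≤t = begin
    blocks-containing H * c                         ≡⟨ ∑-*ʳ c (λ B → 𝟙-block B * 𝟙[ H ⊆? B ]) ⟨
    ∑ (λ B → 𝟙-block B * 𝟙[ H ⊆? B ] * c)           ≡⟨ ∑-cong (λ B → *-assoc (𝟙-block B) 𝟙[ H ⊆? B ] c) ⟩
    ∑ (λ B → 𝟙-block B * (𝟙[ H ⊆? B ] * c))
      ≡⟨ ∑-cong (λ B → 𝟙-*-cong (T? (f B)) (∑-between-block {H} h≤t)) ⟩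
    ∑ (λ B → 𝟙-block B * ∑ (between H B t))         ≡⟨ ∑-cong (λ B → ∑-*ˡ (𝟙-block B) (between H B t)) ⟨
    ∑ (λ B → ∑ (λ X → 𝟙-block B * between H B t X)) ≡⟨ ∑-swap (λ B X → 𝟙-block B * between H B t X) ⟩
    ∑ (λ X → ∑ (λ B → 𝟙-block B * between H B t X)) ≡⟨ ∑-cong (∑-blocks-between H) ⟩
    ∑ (between H ⊤ t)                               ≡⟨ ∑-between H ⊤ t ⊆⊤ h≤t ⟩
    (∣ ⊤ {v} ∣ ∸ ∣ H ∣) C (t ∸ ∣ H ∣)               ≡⟨ cong (λ n → (n ∸ ∣ H ∣) C (t ∸ ∣ H ∣)) (∣⊤∣≡n v) ⟩
    (v ∸ ∣ H ∣) C (t ∸ ∣ H ∣)                       ∎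
    where
    open ≡-Reasoning
    c : ℕ
    c = (k ∸ ∣ H ∣) C (t ∸ ∣ H ∣)

IsDesign⇒InD : ∀ {v k t f} → IsDesign v k t f → k ≤ v → t ≤ v → InD k t v
IsDesign⇒InD {v} {k} {t} design k≤v t≤v = k≤v , divisible
  where
  divisible : ∀ h → h < t → ((k ∸ h) C (t ∸ h)) ∣ ((v ∸ h) C (t ∸ h))
  divisible h h<t with ∃-superset-of-size ⊥ (subst (_≤ h) (sym (∣⊥∣≡0 v)) z≤n) (≤-trans (<⇒≤ h<t) t≤v)
  ... | H , _ , refl =
    divides (blocks-containing design H) (sym (blocks-containing-×-C design H (<⇒≤ h<t)))

-- Deciding the existence of a configuration

allSubsets? : ∀ {v p} {P : Pred (Subset v) p} → Decidable P → Dec (∀ S → P S)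
allSubsets? P? with anySubset? (¬? ∘ P?)
... | yes (S , ¬PS) = no λ ∀P → ¬PS (∀P S)
... | no ∄¬P = yes λ S → decidable-stable (P? S) λ ¬PS → ∄¬P (S , ¬PS)

IsDesign? : ∀ {v} k t (f : Subset v → Bool) → Dec (IsDesign v k t f)
IsDesign? k t f = map′ (λ (s , u) → mkIsDesign s u) (λ (mkIsDesign s u) → s , u)
  (allSubsets? (λ B → T? (f B) →-dec ∣ B ∣ ≟ k) ×-dec
   allSubsets? (λ S → ∣ S ∣ ≟ t →-dec anySubset? λ B →
     (T? (f B) ×-dec S ⊆? B) ×-dec map′ (λ u {B′} → u B′) (λ u B′ → u)
       (allSubsets? λ B′ → (T? (f B′) ×-dec S ⊆? B′) →-dec B ≟ˢ B′)))

IsDesign-resp-≗ : ∀ {v k t} {f g : Subset v → Bool} → f ≗ g → IsDesign v k t f → IsDesign v k t g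
IsDesign-resp-≗ {f = f} {g} f≗g (mkIsDesign block-size unique-block) = mkIsDesign
  (λ B gB → block-size B (g⇒f gB))
  λ S ∣S∣≡t → let B , (fB , S⊆B) , unique = unique-block S ∣S∣≡t
              in B , (f⇒g fB , S⊆B) , λ (gB′ , S⊆B′) → unique (g⇒f gB′ , S⊆B′)
  where
  f⇒g : ∀ {B} → T (f B) → T (g B)
  f⇒g {B} = subst T (f≗g B)
  g⇒f : ∀ {B} → T (g B) → T (f B)
  g⇒f {B} = subst T (sym (f≗g B))

_⊕_ : ∀ {v} → (Subset v → Bool) → (Subset v → Bool) → Subset (suc v) → Bool
(g ⊕ h) (outside ∷ S) = g S
(g ⊕ h) (inside ∷ S) = h S

⊕-cong : ∀ {v} {g g′ h h′ : Subset v → Bool} → g ≗ g′ → h ≗ h′ → g ⊕ h ≗ g′ ⊕ h′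
⊕-cong g≗g′ _ (outside ∷ S) = g≗g′ S
⊕-cong _ h≗h′ (inside ∷ S) = h≗h′ S

anyFamily? : ∀ v {p} {P : (Subset v → Bool) → Set p} → (∀ {f g} → f ≗ g → P f → P g) →
  (∀ f → Dec (P f)) → Dec (∃ P)
anyFamily? zero {P = P} resp P? =
  map′ [ (_ ,_) , (_ ,_) ]′ by-value (P? (const true) ⊎-dec P? (const false))
  where
  by-value : ∃ P → P (const true) ⊎ P (const false)
  by-value (f , Pf) with f [] in f[]
  ... | true = inj₁ (resp (λ { [] → f[] }) Pf)
  ... | false = inj₂ (resp (λ { [] → f[] }) Pf)
anyFamily? (suc v) {P = P} resp P? =
  map′ (λ (g , h , Pg⊕h) → g ⊕ h , Pg⊕h) split
       (anyFamily? v (λ g≗g′ (h , Pg⊕h) → h , resp (⊕-cong g≗g′ λ _ → refl) Pg⊕h) λ g →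
        anyFamily? v (resp ∘ ⊕-cong λ _ → refl) λ h → P? (g ⊕ h))
  where
  split : ∃ P → ∃ λ g → ∃ λ h → P (g ⊕ h)
  split (f , Pf) = f ∘ (outside ∷_) , f ∘ (inside ∷_) , resp (λ { (outside ∷ S) → refl ; (inside ∷ S) → refl }) Pf

record Enumeration {v} (f : Subset v → Bool) : Set where
  field
    size     : ℕ
    elem     : Fin size → Subset v
    injective : Injective _≡_ _≡_ elem
    elem-∈   : ∀ i → T (f (elem i))
    onto     : ∀ {B} → T (f B) → ∃ λ i → elem i ≡ B

enumerate : ∀ {v} (f : Subset v → Bool) → Enumeration f
enumerate {zero} f with f [] in f[]
... | true = record
  { size = 1 ; elem = λ _ → [] ; injective = λ { {zero} {zero} _ → refl }
  ; elem-∈ = λ { zero → subst T (sym f[]) _ } ; onto = λ { {[]} _ → zero , refl } }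
... | false = record
  { size = 0 ; elem = λ () ; injective = λ { {()} } ; elem-∈ = λ ()
  ; onto = λ { {[]} f[]-holds → contradiction (subst T f[] f[]-holds) λ () } }
enumerate {suc v} f = record
  { size = E₀.size + E₁.size ; elem = elem ; injective = injective
  ; elem-∈ = elem-∈ ∘ splitAt E₀.size ; onto = onto }
  where
  module E₀ = Enumeration (enumerate (f ∘ (outside ∷_)))
  module E₁ = Enumeration (enumerate (f ∘ (inside ∷_)))
  elem⊎ : Fin E₀.size ⊎ Fin E₁.size → Subset (suc v)
  elem⊎ = [ (outside ∷_) ∘ E₀.elem , (inside ∷_) ∘ E₁.elem ]′
  elem : Fin (E₀.size + E₁.size) → Subset (suc v)
  elem = elem⊎ ∘ splitAt E₀.size
  elem⊎-injective : Injective _≡_ _≡_ elem⊎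
  elem⊎-injective {inj₁ i} {inj₁ j} eq = cong inj₁ (E₀.injective (∷-injectiveʳ eq))
  elem⊎-injective {inj₂ i} {inj₂ j} eq = cong inj₂ (E₁.injective (∷-injectiveʳ eq))
  elem⊎-injective {inj₁ i} {inj₂ j} eq = contradiction (∷-injectiveˡ eq) λ ()
  elem⊎-injective {inj₂ i} {inj₁ j} eq = contradiction (∷-injectiveˡ eq) λ ()
  injective : Injective _≡_ _≡_ elem
  injective {i} {j} eq = begin
    i                                      ≡⟨ join-splitAt E₀.size E₁.size i ⟨
    join E₀.size E₁.size (splitAt E₀.size i)
      ≡⟨ cong (join E₀.size E₁.size) (elem⊎-injective {splitAt E₀.size i} {splitAt E₀.size j} eq) ⟩
    join E₀.size E₁.size (splitAt E₀.size j) ≡⟨ join-splitAt E₀.size E₁.size j ⟩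
    j                                      ∎
    where open ≡-Reasoning
  elem-∈ : ∀ i → T (f (elem⊎ i))
  elem-∈ (inj₁ i) = E₀.elem-∈ i
  elem-∈ (inj₂ i) = E₁.elem-∈ i
  onto : ∀ {B} → T (f B) → ∃ λ i → elem i ≡ B
  onto {outside ∷ B} fB = let i , eq = E₀.onto fB in
    i ↑ˡ E₁.size , trans (cong elem⊎ (splitAt-↑ˡ E₀.size i E₁.size)) (cong (outside ∷_) eq)
  onto {inside ∷ B} fB = let i , eq = E₁.onto fB in
    E₀.size ↑ʳ i , trans (cong elem⊎ (splitAt-↑ʳ E₀.size E₁.size i)) (cong (inside ∷_) eq)

Configuration⇒IsDesign : ∀ {v k t} → Configuration v k t → ∃ (IsDesign v k t)
Configuration⇒IsDesign {v} {k} {t} C = is-block , mkIsDesign block-size unique-block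
  where
  open Configuration C
  is-block? : ∀ B → Dec (∃ λ i → block i ≡ B)
  is-block? B = any? λ i → block i ≟ˢ B
  is-block : Subset v → Bool
  is-block B = isYes (is-block? B)
  block-size : ∀ B → T (is-block B) → ∣ B ∣ ≡ k
  block-size B B-block = let i , block-i≡B = toWitness B-block in
    trans (cong ∣_∣ (sym block-i≡B)) (blockSz i)
  unique-block : ∀ S → ∣ S ∣ ≡ t → ∃! _≡_ λ B → T (is-block B) × S ⊆ B
  unique-block S ∣S∣≡t =
    let i , S⊆block-i , unique-i = unique S ∣S∣≡t in
    block i , (fromWitness (i , refl) , S⊆block-i) , λ (B′-block , S⊆B′) →
      let j , block-j≡B′ = toWitness B′-block in
      trans (cong block (sym (unique-i j (subst (S ⊆_) (sym block-j≡B′) S⊆B′)))) block-j≡B′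

IsDesign⇒Configuration : ∀ {v k t f} → IsDesign v k t f → Configuration v k t
IsDesign⇒Configuration {t = t} {f} (mkIsDesign block-size unique-block) = record
  { b = size ; block = elem ; blockSz = λ i → block-size (elem i) (elem-∈ i) ; unique = unique }
  where
  open Enumeration (enumerate f)
  unique : ∀ S → ∣ S ∣ ≡ t → Σ (Fin size) λ i → (S ⊆ elem i) × (∀ j → S ⊆ elem j → j ≡ i)
  unique S ∣S∣≡t =
    let B , (fB , S⊆B) , unique-B = unique-block S ∣S∣≡t
        i , elem-i≡B = onto fB
    in i , subst (S ⊆_) (sym elem-i≡B) S⊆B ,
       λ j S⊆elem-j → injective (trans (sym (unique-B (elem-∈ j , S⊆elem-j))) (sym elem-i≡B))

configuration? : ∀ v k t → Dec (Configuration v k t)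
configuration? v k t =
  map′ (IsDesign⇒Configuration ∘ proj₂) Configuration⇒IsDesign
       (anyFamily? v IsDesign-resp-≗ (IsDesign? k t))

-- Skeleta of simplices

IsFace-resp-∣∣ : ∀ ℓ {m n} (S : Subset (suc m)) (R : Subset (suc n)) →
  ∣ R ∣ ≡ ∣ S ∣ → IsFace ℓ m S → IsFace ℓ n R
IsFace-resp-∣∣ ℓ S R ∣R∣≡∣S∣ face = subst (λ k → 1 ≤ k × k ≤ suc ℓ) (sym ∣R∣≡∣S∣) face

IsTopFace⇒IsFace : ∀ {ℓ n} (S : Subset (suc n)) → IsTopFace ℓ n S → IsFace ℓ n S
IsTopFace⇒IsFace S ∣S∣≡1+ℓ rewrite ∣S∣≡1+ℓ = s≤s z≤n , ≤-refl

singleton-face : ∀ ℓ {n} (x : Fin (suc n)) → IsFace ℓ n ⁅ x ⁆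
singleton-face ℓ x rewrite ∣⁅x⁆∣≡1 x = s≤s z≤n , s≤s z≤n

face? : ∀ ℓ {n} S → Dec (IsFace ℓ n S)
face? ℓ S = 1 ≤? ∣ S ∣ ×-dec ∣ S ∣ ≤? suc ℓ

skeleton : ∀ ℓ {n} → Subset (suc n) → Subset (suc n) → Bool
skeleton ℓ B S = isYes (face? ℓ S ×-dec S ⊆? B)

module _ {ℓ n : ℕ} {B S : Subset (suc n)} where

  skeleton⁺ : IsFace ℓ n S → S ⊆ B → T (skeleton ℓ B S)
  skeleton⁺ face S⊆B = fromWitness {a? = face? ℓ S ×-dec S ⊆? B} (face , S⊆B)

  skeleton⁻ : T (skeleton ℓ B S) → IsFace ℓ n S × S ⊆ B
  skeleton⁻ = toWitness

module _ {ℓ n : ℕ} (B : Subset (suc n)) where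

  skeleton-subcomplex : Subcomplex ℓ n (skeleton ℓ B)
  skeleton-subcomplex = record
    { faces = λ S S∈ → proj₁ (skeleton⁻ S∈)
    ; closed = λ S R S∈ R⊆S 1≤∣R∣ → let (_ , ∣S∣≤1+ℓ) , S⊆B = skeleton⁻ S∈ in
        skeleton⁺ (1≤∣R∣ , ≤-trans (p⊆q⇒∣p∣≤∣q∣ R⊆S) ∣S∣≤1+ℓ) (⊆-trans R⊆S S⊆B)
    }

  skeleton-iso : ∣ B ∣ ≡ suc (suc ℓ) → IsoToBoundarySimplex ℓ n (skeleton ℓ B)
  skeleton-iso e = record
    { to = λ S _ → expand B e S
    ; to-in = λ S face →
        skeleton⁺ (IsFace-resp-∣∣ ℓ S (expand B e S) (∣expand∣≡∣S∣ B e S) face) (expand⊆V B e S)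
    ; from = λ R _ → compress B e R
    ; from-in = λ R R∈ → let face , R⊆B = skeleton⁻ R∈ in
        IsFace-resp-∣∣ ℓ R (compress B e R) (∣compress∣≡∣R∣ B e R⊆B) face
    ; from-to = λ S _ → compress-expand B e S
    ; to-from = λ R R∈ → expand-compress B e (proj₂ (skeleton⁻ R∈))
    ; mono = λ _ _ _ _ → expand-mono B e
    ; reflect = λ _ _ _ _ → expand-reflect B e
    }

Configuration⇒Decomposition : ∀ {ℓ n} → ℓ ≤ n →
  Configuration (suc n) (suc (suc ℓ)) (suc ℓ) → Decomposition ℓ n
Configuration⇒Decomposition {ℓ} {n} ℓ≤n C = record
  { r = b ; L = L ; sub = skeleton-subcomplex ∘ block ; iso = λ i → skeleton-iso (block i) (blockSz i)
  ; cover = cover ; exact = exact }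
  where
  open Configuration C
  L : Fin b → Subset (suc n) → Bool
  L i = skeleton ℓ (block i)
  cover : ∀ S → IsFace ℓ n S → ∃[ i ] T (L i S)
  cover S face@(_ , ∣S∣≤1+ℓ) =
    let X , S⊆X , ∣X∣≡1+ℓ = ∃-superset-of-size S ∣S∣≤1+ℓ (s≤s ℓ≤n)
        i , X⊆block-i , _ = unique X ∣X∣≡1+ℓ
    in i , skeleton⁺ face (⊆-trans S⊆X X⊆block-i)
  exact : ∀ S → IsTopFace ℓ n S → Σ (Fin b) λ i → T (L i S) × (∀ j → T (L j S) → j ≡ i)
  exact S ∣S∣≡1+ℓ =
    let i , S⊆block-i , unique-i = unique S ∣S∣≡1+ℓ
    in i , skeleton⁺ (IsTopFace⇒IsFace S ∣S∣≡1+ℓ) S⊆block-i ,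
       λ j S∈L-j → unique-i j (proj₂ (skeleton⁻ S∈L-j))

∈-tabulate⁺ : ∀ {v} (g : Fin v → Bool) {x} → T (g x) → x ∈ tabulate g
∈-tabulate⁺ g {x} gx = lookup⇒[]= x (tabulate g) (trans (lookup∘tabulate g x) (Equivalence.to Bool.T-≡ gx))

∈-tabulate⁻ : ∀ {v} (g : Fin v → Bool) {x} → x ∈ tabulate g → T (g x)
∈-tabulate⁻ g {x} x∈ = Equivalence.from Bool.T-≡ (trans (sym (lookup∘tabulate g x)) ([]=⇒lookup x∈))

-- The minimal faces of Δ_{ℓ+1}^ℓ are singletons, so the isomorphism maps them to singletons ⁅ vertex j ⁆;
-- these are the ℓ + 2 vertices of L, and every (ℓ+1)-subset of them is a face of L.
module VertexSet {ℓ n : ℕ} {L : Subset (suc n) → Bool}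
                 (subcomplex : Subcomplex ℓ n L) (iso : IsoToBoundarySimplex ℓ n L) where
  open Subcomplex subcomplex
  open IsoToBoundarySimplex iso

  to-cong : ∀ {S S′} p p′ → S ≡ S′ → to S p ≡ to S′ p′
  to-cong {S} (a , b) (a′ , b′) refl = cong (to S) (cong₂ _,_ (≤-irrelevant a a′) (≤-irrelevant b b′))

  from-cong : ∀ {R R′} q q′ → R ≡ R′ → from R q ≡ from R′ q′
  from-cong {R} q q′ refl = cong (from R) (Bool.T-irrelevant q q′)

  to-injective : ∀ {S S′} p p′ → to S p ≡ to S′ p′ → S ≡ S′
  to-injective {S} {S′} p p′ eq = trans (sym (from-to S p)) (trans (from-cong _ _ eq) (from-to S′ p′))

  singleton∈L : ∀ {R x} → T (L R) → x ∈ R → T (L ⁅ x ⁆)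
  singleton∈L {R} {x} R∈L x∈R = closed R ⁅ x ⁆ R∈L (x∈p⇒⁅x⁆⊆p x∈R) (proj₁ (singleton-face ℓ x))

  corner : Fin (suc (suc ℓ)) → Subset (suc n)
  corner j = to ⁅ j ⁆ (singleton-face ℓ j)

  corner∈L : ∀ j → T (L (corner j))
  corner∈L j = to-in ⁅ j ⁆ (singleton-face ℓ j)

  corner-singleton : ∀ j {x} → x ∈ corner j → corner j ≡ ⁅ x ⁆
  corner-singleton j {x} x∈ = trans (to-cong _ _ (sym R≡⁅j⁆)) (to-from ⁅ x ⁆ ⁅x⁆∈L)
    where
    ⁅x⁆∈L : T (L ⁅ x ⁆)
    ⁅x⁆∈L = singleton∈L (corner∈L j) x∈
    R : Subset (suc (suc ℓ))
    R = from ⁅ x ⁆ ⁅x⁆∈L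
    R-face : IsFace ℓ (suc ℓ) R
    R-face = from-in ⁅ x ⁆ ⁅x⁆∈L
    R⊆⁅j⁆ : R ⊆ ⁅ j ⁆
    R⊆⁅j⁆ = reflect R R-face ⁅ j ⁆ (singleton-face ℓ j)
              (subst (_⊆ corner j) (sym (to-from ⁅ x ⁆ ⁅x⁆∈L)) (x∈p⇒⁅x⁆⊆p x∈))
    R≡⁅j⁆ : R ≡ ⁅ j ⁆
    R≡⁅j⁆ = p⊆q∧∣q∣≤∣p∣⇒p≡q R⊆⁅j⁆ (≤-trans (≤-reflexive (∣⁅x⁆∣≡1 j)) (proj₁ R-face))

  vertex : Fin (suc (suc ℓ)) → Fin (suc n)
  vertex j = proj₁ (1≤∣p∣⇒Nonempty (corner j) (proj₁ (faces _ (corner∈L j))))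

  corner≡⁅vertex⁆ : ∀ j → corner j ≡ ⁅ vertex j ⁆
  corner≡⁅vertex⁆ j = corner-singleton j (proj₂ (1≤∣p∣⇒Nonempty (corner j) (proj₁ (faces _ (corner∈L j)))))

  vertex∈corner : ∀ j → vertex j ∈ corner j
  vertex∈corner j = subst (vertex j ∈_) (sym (corner≡⁅vertex⁆ j)) (x∈⁅x⁆ (vertex j))

  vertex-injective : ∀ {i j} → vertex i ≡ vertex j → i ≡ j
  vertex-injective {i} {j} eq = ⁅⁆-injective (to-injective _ _ (begin
    corner i         ≡⟨ corner≡⁅vertex⁆ i ⟩
    ⁅ vertex i ⁆     ≡⟨ cong ⁅_⁆ eq ⟩
    ⁅ vertex j ⁆     ≡⟨ corner≡⁅vertex⁆ j ⟨
    corner j         ∎))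
    where open ≡-Reasoning

  is-vertex : Fin (suc n) → Bool
  is-vertex x = L ⁅ x ⁆

  vertices : Subset (suc n)
  vertices = tabulate is-vertex

  vertex∈vertices : ∀ j → vertex j ∈ vertices
  vertex∈vertices j = ∈-tabulate⁺ is-vertex (subst (T ∘ L) (corner≡⁅vertex⁆ j) (corner∈L j))

  vertex-onto : ∀ {x} → x ∈ vertices → ∃ λ j → vertex j ≡ x
  vertex-onto {x} x∈ = j , x∈⁅y⁆⇒x≡y x (corner⊆⁅x⁆ (vertex∈corner j))
    where
    ⁅x⁆∈L : T (L ⁅ x ⁆)
    ⁅x⁆∈L = ∈-tabulate⁻ is-vertex x∈
    F : Subset (suc (suc ℓ))
    F = from ⁅ x ⁆ ⁅x⁆∈L
    F-face : IsFace ℓ (suc ℓ) F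
    F-face = from-in ⁅ x ⁆ ⁅x⁆∈L
    j : Fin (suc (suc ℓ))
    j = proj₁ (1≤∣p∣⇒Nonempty F (proj₁ F-face))
    j∈F : j ∈ F
    j∈F = proj₂ (1≤∣p∣⇒Nonempty F (proj₁ F-face))
    corner⊆⁅x⁆ : corner j ⊆ ⁅ x ⁆
    corner⊆⁅x⁆ = subst (corner j ⊆_) (to-from ⁅ x ⁆ ⁅x⁆∈L)
                   (mono ⁅ j ⁆ (singleton-face ℓ j) F F-face (x∈p⇒⁅x⁆⊆p j∈F))

  ∣vertices∣ : ∣ vertices ∣ ≡ suc (suc ℓ)
  ∣vertices∣ = injective-onto⇒∣p∣≡ vertices vertex vertex-injective vertex∈vertices vertex-onto

  face⊆vertices : ∀ {S} → T (L S) → S ⊆ vertices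
  face⊆vertices S∈L x∈S = ∈-tabulate⁺ is-vertex (singleton∈L S∈L x∈S)

  -- S is the image of F = vertex⁻¹ S, a proper nonempty subset since ∣ S ∣ < ∣ vertices ∣.
  top-face∈L : ∀ {S} → ∣ S ∣ ≡ suc ℓ → S ⊆ vertices → T (L S)
  top-face∈L {S} ∣S∣≡1+ℓ S⊆vertices = subst (T ∘ L) (sym S≡to-F) (to-in F F-face)
    where
    in-S : Fin (suc (suc ℓ)) → Bool
    in-S j = isYes (vertex j ∈? S)
    F : Subset (suc (suc ℓ))
    F = tabulate in-S
    ∈F⁺ : ∀ {j} → vertex j ∈ S → j ∈ F
    ∈F⁺ vj∈S = ∈-tabulate⁺ in-S (fromWitness vj∈S)
    ∈F⁻ : ∀ {j} → j ∈ F → vertex j ∈ S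
    ∈F⁻ j∈F = toWitness (∈-tabulate⁻ in-S j∈F)
    ∈S⇒∈vertex : ∀ {x} → x ∈ S → ∃ λ j → j ∈ F × vertex j ≡ x
    ∈S⇒∈vertex x∈S = let j , vj≡x = vertex-onto (S⊆vertices x∈S) in
      j , ∈F⁺ (subst (_∈ S) (sym vj≡x) x∈S) , vj≡x
    F≢⊤ : ∣ F ∣ ≢ suc (suc ℓ)
    F≢⊤ ∣F∣≡ℓ+2 = <-irrefl refl (subst₂ _≤_ ∣vertices∣ ∣S∣≡1+ℓ (p⊆q⇒∣p∣≤∣q∣ vertices⊆S))
      where
      vertices⊆S : vertices ⊆ S
      vertices⊆S x∈ = let j , vj≡x = vertex-onto x∈ in
        subst (_∈ S) vj≡x (∈F⁻ (subst (j ∈_) (sym (∣p∣≡n⇒p≡⊤ ∣F∣≡ℓ+2)) ∈⊤))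
    F-face : IsFace ℓ (suc ℓ) F
    F-face = x∈p⇒1≤∣p∣ (proj₁ (proj₂ (∈S⇒∈vertex (proj₂ S-nonempty)))) , ≤-pred (≤∧≢⇒< (∣p∣≤n F) F≢⊤)
      where
      S-nonempty : Nonempty S
      S-nonempty = 1≤∣p∣⇒Nonempty S (proj₁ (IsTopFace⇒IsFace {ℓ} S ∣S∣≡1+ℓ))
    S⊆to-F : S ⊆ to F F-face
    S⊆to-F x∈S = let j , j∈F , vj≡x = ∈S⇒∈vertex x∈S in
      subst (_∈ to F F-face) vj≡x
            (mono ⁅ j ⁆ (singleton-face ℓ j) F F-face (x∈p⇒⁅x⁆⊆p j∈F) (vertex∈corner j))
    S≡to-F : S ≡ to F F-face
    S≡to-F = p⊆q∧∣q∣≤∣p∣⇒p≡q S⊆to-F (≤-trans (proj₂ (faces _ (to-in F F-face))) (≤-reflexive (sym ∣S∣≡1+ℓ)))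

Decomposition⇒Configuration : ∀ {ℓ n} → Decomposition ℓ n → Configuration (suc n) (suc (suc ℓ)) (suc ℓ)
Decomposition⇒Configuration {ℓ} D = record
  { b = r ; block = V.vertices ; blockSz = V.∣vertices∣ ; unique = unique }
  where
  open Decomposition D
  module V i = VertexSet (sub i) (iso i)
  unique : ∀ S → ∣ S ∣ ≡ suc ℓ → Σ (Fin r) λ i → (S ⊆ V.vertices i) × (∀ j → S ⊆ V.vertices j → j ≡ i)
  unique S ∣S∣≡1+ℓ =
    let i , S∈L-i , unique-i = exact S ∣S∣≡1+ℓ
    in i , V.face⊆vertices i S∈L-i , λ j S⊆vertices-j → unique-i j (V.top-face∈L j ∣S∣≡1+ℓ S⊆vertices-j)

Configuration⇒InD : ∀ {v k t} → k ≤ v → t ≤ v → Configuration v k t → InD k t v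
Configuration⇒InD k≤v t≤v C = IsDesign⇒InD (proj₂ (Configuration⇒IsDesign C)) k≤v t≤v

theorem2 : (ℓ n : ℕ) → 1 ≤ ℓ → suc ℓ ≤ n →
    Decomposition ℓ n ⇔ (InD (ℓ + 2) (ℓ + 1) (n + 1) × ¬ InX (ℓ + 2) (ℓ + 1) (n + 1))
theorem2 ℓ n _ ℓ<n rewrite +-comm ℓ 2 | +-comm ℓ 1 | +-comm n 1 = mk⇔ to from
  where
  to : Decomposition ℓ n → InD (2 + ℓ) (1 + ℓ) (1 + n) × ¬ InX (2 + ℓ) (1 + ℓ) (1 + n)
  to D = Configuration⇒InD (s≤s ℓ<n) (m≤n⇒m≤1+n ℓ<n) C , λ (_ , ¬C) → ¬C C
    where
    C : Configuration (1 + n) (2 + ℓ) (1 + ℓ)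
    C = Decomposition⇒Configuration D
  from : InD (2 + ℓ) (1 + ℓ) (1 + n) × ¬ InX (2 + ℓ) (1 + ℓ) (1 + n) → Decomposition ℓ n
  -- ¬ InX only excludes the absence of a configuration; decidability turns that into one.
  from (inD , ¬inX) = Configuration⇒Decomposition (<⇒≤ ℓ<n)
    (decidable-stable (configuration? (1 + n) (2 + ℓ) (1 + ℓ)) λ ¬C → ¬inX (inD , ¬C))
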